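{- Let $X=X_0\cup X_1\cup\dots\cup X_d$ be a finite set of labels with $X_0=\{x\}$, and let $Y$ be a finite set of labelled trees (patterns). Then the language $L(X|Y)$ of Polish-notation words of labelled trees avoiding $Y$ is a deterministic context-free language.
   Context: Labelled trees: planar rooted trees whose vertices other than the root carry labels from a finite set $X=X_0\cup\dots\cup X_d$ ($d>0$), where $X_i$ is the set of labels of vertices having exactly $i$ children; $X_0=\{x\}$ and vertices labelled $x$ are leaves called free ends. Grafting a tree $s$ onto a free end of a tree $t$ means identifying the root edge of $s$ with that free end. A tree $T$ avoids a set $Y$ of patterns if $T$ cannot be obtained by successively grafting several trees onto each other with at least one of them an element of $Y$; equivalently, $T$ contains no subtree isomorphic (as a labelled planar tree) to an element of $Y$. Each labelled tree is encoded in Polish (prefix) notation as a word over the alphabet $X$: the label of the top vertex followed by the encodings of its children's subtrees from left to right, free ends encoded as $x$. $L(X|Y)$ is the set of such words of all trees avoiding $Y$. -}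

module Defs where

open import Data.Nat using (ℕ; zero; suc)
open import Data.Fin using (Fin; zero; suc)
open import Data.Bool using (Bool; true)
open import Data.Maybe using (Maybe; just; nothing)
open import Data.List using (List; []; _∷_; _++_)
open import Data.List.Membership.Propositional using (_∈_)
open import Data.Vec using (Vec; []; _∷_)
open import Data.Vec.Relation.Binary.Pointwise.Inductive using (Pointwise)
open import Data.Vec.Relation.Unary.Any using (Any)
open import Data.Product using (Σ; _×_; _,_; ∃)
open import Relation.Nullary using (¬_)
open import Relation.Binary.PropositionalEquality using (_≡_; _≢_)
open import Relation.Binary.Construct.Closure.ReflexiveTransitive using (Star)
open import Function.Bundles using (_⇔_)

-- Labelled trees over X = {x} ∪ X₁ ∪ … ∪ X_d.
-- The non-free-end labels are Fin k; label i has ar i children.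
-- The alphabet X is Fin (suc k): zero is the free end x, suc i is label i.

module Trees {k : ℕ} (ar : Fin k → ℕ) where

  Label : Set
  Label = Fin (suc k)

  -- a tree, given by its top vertex (the child of the unlabelled root)
  data Tree : Set where
    leaf : Tree
    node : (i : Fin k) → Vec Tree (ar i) → Tree

  -- p ≼ t : the pattern p matches t at its top vertex, i.e. t is obtained
  -- from p by grafting trees onto (some of) the free ends of p
  data _≼_ : Tree → Tree → Set where
    leaf≼ : ∀ {t} → leaf ≼ t
    node≼ : ∀ {i ps ts} → Pointwise _≼_ ps ts → node i ps ≼ node i ts

  data _occursIn_ (p : Tree) : Tree → Set where
    here  : ∀ {t} → p ≼ t → p occursIn t
    there : ∀ {i ts} → Any (p occursIn_) ts → p occursIn node i ts

  Avoids : List Tree → Tree → Set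
  Avoids Y t = ∀ p → p ∈ Y → ¬ (p occursIn t)

  mutual
    polish : Tree → List Label
    polish leaf = zero ∷ []
    polish (node i ts) = suc i ∷ polishs ts

    polishs : ∀ {n} → Vec Tree n → List Label
    polishs [] = []
    polishs (t ∷ ts) = polish t ++ polishs ts

  L : List Tree → List Label → Set
  L Y w = Σ Tree λ t → Avoids Y t × polish t ≡ w

record DPDA (A : Set) : Set₁ where
  field
    nQ nΓ   : ℕ
    q₀      : Fin nQ
    Z₀      : Fin nΓ
    final   : Fin nQ → Bool
    δε      : Fin nQ → Fin nΓ → Maybe (Fin nQ × List (Fin nΓ))
    δ       : Fin nQ → A → Fin nΓ → Maybe (Fin nQ × List (Fin nΓ))
    deterministic : ∀ q Z → δε q Z ≢ nothing → ∀ a → δ q a Z ≡ nothing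

  Config : Set
  Config = Fin nQ × List A × List (Fin nΓ)

  data _⊢_ : Config → Config → Set where
    ε-step : ∀ {q Z w s q′ γ} → δε q Z ≡ just (q′ , γ) →
             (q , w , Z ∷ s) ⊢ (q′ , w , γ ++ s)
    a-step : ∀ {q Z a w s q′ γ} → δ q a Z ≡ just (q′ , γ) →
             (q , a ∷ w , Z ∷ s) ⊢ (q′ , w , γ ++ s)

  Accepts : List A → Set
  Accepts w = ∃ λ q → ∃ λ s → final q ≡ true ×
              Star _⊢_ (q₀ , w , Z₀ ∷ []) (q , [] , s)

DeterministicCF : {A : Set} → (List A → Set) → Set₁
DeterministicCF {A} L = Σ (DPDA A) λ M → ∀ w → L w ⇔ DPDA.Accepts M w

{-# OPTIONS --safe #-}
-- Whether a pattern of height at most E matches a tree at its top vertex depends only on the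
-- truncation of the tree at depth E, and the truncations at a fixed depth form a finite set. A
-- pushdown automaton reading a Polish word can therefore keep on its stack, for each vertex whose
-- subtree is still being read, its label and the truncations of the children read so far. When the
-- last child of a vertex has been read, it assembles the truncation of the vertex's subtree, rejects
-- if a pattern of Y matches there, and otherwise hands the truncation on to the parent. Its moves
-- depend only on the state and the top of the stack, and both range over finite sets.
module Submission where

open import Data.Bool using (Bool; true; false)
open import Data.Fin using (Fin; zero; suc; _≟_)
open import Data.List
  using (List; []; _∷_; _++_; _∷ʳ_; map; length; lookup; allFin; concatMap; cartesianProductWith)
open import Data.List.Extrema.Nat using (max; xs≤max)
open import Data.List.Membership.Propositional using (_∈_; lose)
open import Data.List.Membership.Propositional.Properties
  using (∈-map⁺; ∈-allFin; ∈-concatMap⁺; ∈-cartesianProductWith⁺)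
open import Data.List.Properties using (map-++; length-map; length-++; ++-assoc; ++-identityʳ)
open import Data.List.Relation.Unary.All using (All; []; _∷_)
import Data.List.Relation.Unary.All as All
import Data.List.Relation.Unary.All.Properties as AllP
open import Data.List.Relation.Unary.Any using (here; there; index)
open import Data.List.Relation.Unary.Any.Properties using (lookup-index)
open import Data.Maybe using (Maybe; just; nothing)
import Data.Maybe as Maybe
open import Data.Nat using (ℕ; zero; suc; _+_; _≤_; _<_; _⊔_; z≤n; s≤s; z<s)
open import Data.Nat.Properties
  using ( +-comm; m⊔n≤o⇒m≤o; m⊔n≤o⇒n≤o; <-irrelevant; m≤n⇒m≤1+n; m≤n⇒m<n∨m≡n; <⇒≢; m<m+n
        ; module ≤-Reasoning)
open import Data.Product using (Σ; _×_; _,_; ∃; proj₁; proj₂)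
open import Data.Sum using (inj₁; inj₂)
open import Data.Vec using (Vec; []; _∷_; toList; fromList; cast)
open import Data.Vec.Properties using (length-toList; toList-cast; toList∘fromList; toList-injective)
open import Data.Vec.Relation.Binary.Equality.Cast using (cast-is-id)
open import Data.Vec.Relation.Binary.Pointwise.Inductive using (Pointwise; []; _∷_)
import Data.Vec.Relation.Unary.All as VAll
import Data.Vec.Relation.Unary.All.Properties as VAllP
import Data.Vec.Relation.Unary.Any as VAny
open import Function using (_∘_)
open import Function.Bundles using (_⇔_; mk⇔)
open import Function.Construct.Composition using (_⇔-∘_)
open import Relation.Binary.Construct.Closure.ReflexiveTransitive using (Star; ε; _◅_; _◅◅_; gmap)
open import Relation.Binary.PropositionalEquality
open import Relation.Nullary using (¬_; ¬?; Dec; yes; no; map′; _×-dec_; contradiction)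

open import Defs

Enumerable : Set → Set
Enumerable A = Σ (List A) λ xs → ∀ x → x ∈ xs

enumerate-Fin : ∀ n → Enumerable (Fin n)
enumerate-Fin n = allFin n , ∈-allFin

enumerate-Maybe : ∀ {A} → Enumerable A → Enumerable (Maybe A)
enumerate-Maybe (xs , xs∋) = nothing ∷ map just xs , λ where
  nothing  → here refl
  (just x) → there (∈-map⁺ just (xs∋ x))

enumerate-Σ : ∀ {A} {B : A → Set} → Enumerable A → (∀ a → Enumerable (B a)) →
              Enumerable (Σ A B)
enumerate-Σ {B = B} (xs , xs∋) ys = concatMap pairs xs , λ (a , b) →
  ∈-concatMap⁺ pairs (lose (xs∋ a) (∈-map⁺ (a ,_) (proj₂ (ys a) b)))
  where
  pairs : ∀ a → List (Σ _ B)
  pairs a = map (a ,_) (proj₁ (ys a))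

enumerate-Vec : ∀ {A} → Enumerable A → ∀ n → Enumerable (Vec A n)
enumerate-Vec (xs , xs∋) zero = [] ∷ [] , λ where [] → here refl
enumerate-Vec (xs , xs∋) (suc n) = cartesianProductWith _∷_ xs vs , λ where
    (x ∷ v) → ∈-cartesianProductWith⁺ _∷_ (xs∋ x) (vs∋ v)
  where open Σ (enumerate-Vec (xs , xs∋) n) renaming (proj₁ to vs; proj₂ to vs∋)

BoundedList : Set → ℕ → Set
BoundedList A m = Σ (List A) λ xs → length xs < m

enumerate-BoundedList : ∀ {A} → Enumerable A → ∀ m → Enumerable (BoundedList A m)
enumerate-BoundedList e zero = [] , λ where (_ , ())
enumerate-BoundedList (xs , xs∋) (suc m) = ([] , s≤s z≤n) ∷ cartesianProductWith cons xs bs , λ where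
    ([] , s≤s z≤n)   → here refl
    (x ∷ ys , s≤s p) → there (∈-cartesianProductWith⁺ cons (xs∋ x) (bs∋ (ys , p)))
  where
  open Σ (enumerate-BoundedList (xs , xs∋) m) renaming (proj₁ to bs; proj₂ to bs∋)
  cons : _ → BoundedList _ m → BoundedList _ (suc m)
  cons x (ys , p) = x ∷ ys , s≤s p

record DPDAOver (A Q Γ : Set) : Set where
  field
    q₀      : Q
    Z₀      : Γ
    final   : Q → Bool
    δε      : Q → Γ → Maybe (Q × List Γ)
    δ       : Q → A → Γ → Maybe (Q × List Γ)
    deterministic : ∀ q Z → δε q Z ≢ nothing → ∀ a → δ q a Z ≡ nothing

  Config : Set
  Config = Q × List A × List Γ

  data _⊢_ : Config → Config → Set where
    ε-step : ∀ {q Z w s q′ γ} → δε q Z ≡ just (q′ , γ) →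
             (q , w , Z ∷ s) ⊢ (q′ , w , γ ++ s)
    a-step : ∀ {q Z a w s q′ γ} → δ q a Z ≡ just (q′ , γ) →
             (q , a ∷ w , Z ∷ s) ⊢ (q′ , w , γ ++ s)

  _⊢*_ : Config → Config → Set
  _⊢*_ = Star _⊢_

  Accepts : List A → Set
  Accepts w = ∃ λ q → ∃ λ s → final q ≡ true × (q₀ , w , Z₀ ∷ []) ⊢* (q , [] , s)

map-just-inverse : ∀ {A B : Set} {f : A → B} {g : B → A} → (∀ x → g (f x) ≡ x) →
                   ∀ {m y} → Maybe.map f m ≡ just y → m ≡ just (g y)
map-just-inverse g∘f {just x} refl = cong just (sym (g∘f x))

module Coding {A Q Γ : Set} (M : DPDAOver A Q Γ) (Q-enum : Enumerable Q) (Γ-enum : Enumerable Γ) where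
  open DPDAOver M

  module Code {B : Set} (enum : Enumerable B) where
    open Σ enum renaming (proj₁ to xs; proj₂ to xs∋)

    code : B → Fin (length xs)
    code x = index (xs∋ x)

    decode : Fin (length xs) → B
    decode = lookup xs

    decode-code : ∀ x → decode (code x) ≡ x
    decode-code x = sym (lookup-index (xs∋ x))

  open Code Q-enum renaming (code to codeQ; decode to decodeQ; decode-code to decode-codeQ)
  open Code Γ-enum renaming (code to codeΓ; decode to decodeΓ; decode-code to decode-codeΓ)

  decodeΓ-codeΓ : ∀ γ → map decodeΓ (map codeΓ γ) ≡ γ
  decodeΓ-codeΓ []      = refl
  decodeΓ-codeΓ (Z ∷ γ) = cong₂ _∷_ (decode-codeΓ Z) (decodeΓ-codeΓ γ)

  codeMove : Q × List Γ → Fin _ × List (Fin _)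
  codeMove (q , γ) = codeQ q , map codeΓ γ

  decodeMove : Fin _ × List (Fin _) → Q × List Γ
  decodeMove (q , γ) = decodeQ q , map decodeΓ γ

  decodeMove-codeMove : ∀ m → decodeMove (codeMove m) ≡ m
  decodeMove-codeMove (q , γ) = cong₂ _,_ (decode-codeQ q) (decodeΓ-codeΓ γ)

  coded : DPDA A
  coded = record
    { nQ = _ ; nΓ = _
    ; q₀ = codeQ q₀ ; Z₀ = codeΓ Z₀
    ; final = λ q → final (decodeQ q)
    ; δε = λ q Z → Maybe.map codeMove (δε (decodeQ q) (decodeΓ Z))
    ; δ = λ q a Z → Maybe.map codeMove (δ (decodeQ q) a (decodeΓ Z))
    ; deterministic = λ q Z ne a →
        cong (Maybe.map codeMove) (deterministic _ _ (ne ∘ cong (Maybe.map codeMove)) a)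
    }

  open DPDA coded using () renaming (Config to Configᶜ; _⊢_ to _⊢ᶜ_; Accepts to Acceptsᶜ)

  decodeConfig : Configᶜ → Config
  decodeConfig (q , w , s) = decodeQ q , w , map decodeΓ s

  codeConfig : Config → Configᶜ
  codeConfig (q , w , s) = codeQ q , w , map codeΓ s

  decode-step : ∀ {c c′} → c ⊢ᶜ c′ → decodeConfig c ⊢ decodeConfig c′
  decode-step {_ , _ , _ ∷ s} (DPDA.ε-step {γ = γ} e) rewrite map-++ decodeΓ γ s =
    ε-step (map-just-inverse decodeMove-codeMove e)
  decode-step {_ , _ , _ ∷ s} (DPDA.a-step {γ = γ} e) rewrite map-++ decodeΓ γ s =
    a-step (map-just-inverse decodeMove-codeMove e)

  code-step : ∀ {c c′} → c ⊢ c′ → codeConfig c ⊢ᶜ codeConfig c′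
  code-step {q , _ , Z ∷ s} (ε-step {γ = γ} e) rewrite map-++ codeΓ γ s =
    DPDA.ε-step (cong (Maybe.map codeMove) (trans (cong₂ δε (decode-codeQ q) (decode-codeΓ Z)) e))
  code-step {q , a ∷ _ , Z ∷ s} (a-step {γ = γ} e) rewrite map-++ codeΓ γ s =
    DPDA.a-step (cong (Maybe.map codeMove)
                      (trans (cong₂ (λ q Z → δ q a Z) (decode-codeQ q) (decode-codeΓ Z)) e))

  decode-run : ∀ {c c′} → Star _⊢ᶜ_ c c′ → decodeConfig c ⊢* decodeConfig c′
  decode-run = gmap decodeConfig decode-step

  code-run : ∀ {c c′} → c ⊢* c′ → Star _⊢ᶜ_ (codeConfig c) (codeConfig c′)
  code-run = gmap codeConfig code-step

  accepts-coded : ∀ w → Accepts w ⇔ Acceptsᶜ w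
  accepts-coded w = mk⇔
    (λ (q , s , final-q , run) →
       codeQ q , map codeΓ s , trans (cong final (decode-codeQ q)) final-q , code-run run)
    (λ (q , s , final-q , run) →
       decodeQ q , map decodeΓ s , final-q ,
       subst (_⊢* (decodeQ q , [] , map decodeΓ s)) decode-start (decode-run run))
    where
    decode-start : decodeConfig (codeQ q₀ , w , codeΓ Z₀ ∷ []) ≡ (q₀ , w , Z₀ ∷ [])
    decode-start = cong₂ (λ q Z → q , w , Z ∷ []) (decode-codeQ q₀) (decode-codeΓ Z₀)

deterministicCF : ∀ {A Q Γ} {L : List A → Set} (M : DPDAOver A Q Γ) → Enumerable Q → Enumerable Γ →
                  (∀ w → L w ⇔ DPDAOver.Accepts M w) → DeterministicCF L
deterministicCF M Q-enum Γ-enum L⇔M = coded , λ w → accepts-coded w ⇔-∘ L⇔M w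
  where open Coding M Q-enum Γ-enum

length-∷ʳ : ∀ {A : Set} (xs : List A) {x} → length (xs ∷ʳ x) ≡ suc (length xs)
length-∷ʳ xs = trans (length-++ xs) (+-comm (length xs) 1)

toVec : ∀ {A : Set} {n} (xs : List A) → length xs ≡ n → Vec A n
toVec xs e = cast e (fromList xs)

toList-toVec : ∀ {A : Set} {n} (xs : List A) (e : length xs ≡ n) → toList (toVec xs e) ≡ xs
toList-toVec xs e = trans (toList-cast e (fromList xs)) (toList∘fromList xs)

toList-injective′ : ∀ {A : Set} {n} (xs ys : Vec A n) → toList xs ≡ toList ys → xs ≡ ys
toList-injective′ xs ys eq = trans (sym (cast-is-id refl xs)) (toList-injective refl xs ys eq)

module _ {k : ℕ} (ar : Fin k → ℕ) where
  open Trees ar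

  data Shape : ℕ → Set where
    sleaf : ∀ {n} → Shape n
    snode : ∀ {n} (i : Fin k) → Vec (Shape n) (ar i) → Shape (suc n)

  enumerate-Shape : ∀ n → Enumerable (Shape n)
  enumerate-Shape zero = sleaf ∷ [] , λ where sleaf → here refl
  enumerate-Shape (suc n) = sleaf ∷ map snode′ nodes , λ where
      sleaf        → here refl
      (snode i σs) → there (∈-map⁺ snode′ (nodes∋ (i , σs)))
    where
    open Σ (enumerate-Σ (enumerate-Fin k) λ i → enumerate-Vec (enumerate-Shape n) (ar i))
      renaming (proj₁ to nodes; proj₂ to nodes∋)
    snode′ : (Σ (Fin k) λ i → Vec (Shape n) (ar i)) → Shape (suc n)
    snode′ (i , σs) = snode i σs

  mutual
    truncate : ∀ n → Tree → Shape n
    truncate zero    _           = sleaf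
    truncate (suc n) leaf        = sleaf
    truncate (suc n) (node i ts) = snode i (truncate* n ts)

    truncate* : ∀ n {m} → Vec Tree m → Vec (Shape n) m
    truncate* n []       = []
    truncate* n (t ∷ ts) = truncate n t ∷ truncate* n ts

  toList-truncate* : ∀ n {m} (ts : Vec Tree m) →
                     toList (truncate* n ts) ≡ map (truncate n) (toList ts)
  toList-truncate* n []       = refl
  toList-truncate* n (t ∷ ts) = cong (truncate n t ∷_) (toList-truncate* n ts)

  truncate-node : ∀ n {i cs} (ts : Vec Tree (ar i)) → toList ts ≡ cs →
                  (e : length (map (truncate n) cs) ≡ ar i) →
                  snode i (toVec (map (truncate n) cs) e) ≡ truncate (suc n) (node i ts)
  truncate-node n {i} {cs} ts ts≡cs e = cong (snode i) (toList-injective′ _ _ (begin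
    toList (toVec (map (truncate n) cs) e)  ≡⟨ toList-toVec _ e ⟩
    map (truncate n) cs                     ≡⟨ cong (map (truncate n)) ts≡cs ⟨
    map (truncate n) (toList ts)            ≡⟨ toList-truncate* n ts ⟨
    toList (truncate* n ts)                 ∎))
    where open ≡-Reasoning

  mutual
    lower : ∀ {n} → Shape (suc n) → Shape n
    lower         sleaf        = sleaf
    lower {zero}  (snode _ _)  = sleaf
    lower {suc n} (snode i σs) = snode i (lower* σs)

    lower* : ∀ {n m} → Vec (Shape (suc n)) m → Vec (Shape n) m
    lower* []       = []
    lower* (σ ∷ σs) = lower σ ∷ lower* σs

  mutual
    lower-truncate : ∀ n t → lower (truncate (suc n) t) ≡ truncate n t
    lower-truncate zero    leaf        = refl
    lower-truncate zero    (node _ _)  = refl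
    lower-truncate (suc n) leaf        = refl
    lower-truncate (suc n) (node i ts) = cong (snode i) (lower-truncate* n ts)

    lower-truncate* : ∀ n {m} (ts : Vec Tree m) → lower* (truncate* (suc n) ts) ≡ truncate* n ts
    lower-truncate* n []       = refl
    lower-truncate* n (t ∷ ts) = cong₂ _∷_ (lower-truncate n t) (lower-truncate* n ts)

  mutual
    height : Tree → ℕ
    height leaf        = 0
    height (node _ ps) = suc (height* ps)

    height* : ∀ {m} → Vec Tree m → ℕ
    height* []       = 0
    height* (p ∷ ps) = height p ⊔ height* ps

  maxHeight : List Tree → ℕ
  maxHeight Y = max 0 (map height Y)

  height≤maxHeight : ∀ {p Y} → p ∈ Y → height p ≤ maxHeight Y
  height≤maxHeight {Y = Y} p∈Y = All.lookup (xs≤max 0 (map height Y)) (∈-map⁺ height p∈Y)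

  data _⊑_ : ∀ {n} → Tree → Shape n → Set where
    leaf⊑ : ∀ {n} {σ : Shape n} → leaf ⊑ σ
    node⊑ : ∀ {n i ps} {σs : Vec (Shape n) (ar i)} → Pointwise _⊑_ ps σs → node i ps ⊑ snode i σs

  mutual
    _⊑?_ : ∀ {n} p (σ : Shape n) → Dec (p ⊑ σ)
    leaf      ⊑? σ     = yes leaf⊑
    node i ps ⊑? sleaf = no λ ()
    node i ps ⊑? snode j σs with i ≟ j
    ... | no i≢j   = no λ where (node⊑ _) → i≢j refl
    ... | yes refl = map′ node⊑ (λ where (node⊑ ps⊑σs) → ps⊑σs) (ps ⊑*? σs)

    _⊑*?_ : ∀ {n m} (ps : Vec Tree m) (σs : Vec (Shape n) m) → Dec (Pointwise _⊑_ ps σs)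
    []       ⊑*? []       = yes []
    (p ∷ ps) ⊑*? (σ ∷ σs) =
      map′ (λ (h , t) → h ∷ t) (λ where (h ∷ t) → h , t) ((p ⊑? σ) ×-dec (ps ⊑*? σs))

  mutual
    ⊑-truncate⇒≼ : ∀ {n} p t → p ⊑ truncate n t → p ≼ t
    ⊑-truncate⇒≼         leaf        t           _             = leaf≼
    ⊑-truncate⇒≼ {suc n} (node i ps) (node j ts) (node⊑ ps⊑ts) = node≼ (⊑-truncate*⇒≼* ps ts ps⊑ts)

    ⊑-truncate*⇒≼* : ∀ {n m} (ps ts : Vec Tree m) → Pointwise _⊑_ ps (truncate* n ts) →
                     Pointwise _≼_ ps ts
    ⊑-truncate*⇒≼* []       []       []            = []
    ⊑-truncate*⇒≼* (p ∷ ps) (t ∷ ts) (p⊑t ∷ ps⊑ts) =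
      ⊑-truncate⇒≼ p t p⊑t ∷ ⊑-truncate*⇒≼* ps ts ps⊑ts

  mutual
    ≼⇒⊑-truncate : ∀ {n} p t → height p ≤ n → p ≼ t → p ⊑ truncate n t
    ≼⇒⊑-truncate         leaf        t           _       _             = leaf⊑
    ≼⇒⊑-truncate {suc n} (node i ps) (node i ts) (s≤s h) (node≼ ps≼ts) =
      node⊑ (≼*⇒⊑-truncate* ps ts h ps≼ts)

    ≼*⇒⊑-truncate* : ∀ {n m} (ps ts : Vec Tree m) → height* ps ≤ n → Pointwise _≼_ ps ts →
                     Pointwise _⊑_ ps (truncate* n ts)
    ≼*⇒⊑-truncate* []       []       _ []            = []
    ≼*⇒⊑-truncate* (p ∷ ps) (t ∷ ts) h (p≼t ∷ ps≼ts) =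
      ≼⇒⊑-truncate p t (m⊔n≤o⇒m≤o _ _ h) p≼t ∷ ≼*⇒⊑-truncate* ps ts (m⊔n≤o⇒n≤o _ _ h) ps≼ts

  Admissible : List Tree → ∀ {n} → Shape n → Set
  Admissible Y σ = All (λ p → ¬ p ⊑ σ) Y

  admissible? : ∀ Y {n} (σ : Shape n) → Dec (Admissible Y σ)
  admissible? Y σ = All.all? (λ p → ¬? (p ⊑? σ)) Y

  avoids⇒admissible : ∀ {Y} n {t} → Avoids Y t → Admissible Y (truncate n t)
  avoids⇒admissible n {t} avoids =
    All.tabulate λ p∈Y p⊑t → avoids _ p∈Y (here (⊑-truncate⇒≼ _ t p⊑t))

  avoids-children : ∀ {Y m} {ts : Vec Tree m} → (∀ p → p ∈ Y → ¬ VAny.Any (p occursIn_) ts) →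
                    VAll.All (Avoids Y) ts
  avoids-children {ts = []}     _    = VAll.[]
  avoids-children {ts = t ∷ ts} ¬occ =
    (λ p p∈Y occ → ¬occ p p∈Y (VAny.here occ)) VAll.∷
    avoids-children (λ p p∈Y occ → ¬occ p p∈Y (VAny.there occ))

  module _ {Y : List Tree} {n : ℕ} (bounded : ∀ {p} → p ∈ Y → height p ≤ n) where

    admissible⇒¬≼ : ∀ {t p} → Admissible Y (truncate n t) → p ∈ Y → ¬ p ≼ t
    admissible⇒¬≼ adm p∈Y p≼t = All.lookup adm p∈Y (≼⇒⊑-truncate _ _ (bounded p∈Y) p≼t)

    avoids-leaf : Admissible Y (truncate n leaf) → Avoids Y leaf
    avoids-leaf adm p p∈Y (here p≼leaf) = admissible⇒¬≼ adm p∈Y p≼leaf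

    avoids-node : ∀ {i ts} → Admissible Y (truncate n (node i ts)) → VAll.All (Avoids Y) ts →
                  Avoids Y (node i ts)
    avoids-node adm _    p p∈Y (here p≼t)  = admissible⇒¬≼ adm p∈Y p≼t
    avoids-node _   avss p p∈Y (there occ) = VAll.lookupWith (λ avoids → avoids p p∈Y) avss occ

  polishes : List Tree → List Label
  polishes []       = []
  polishes (t ∷ ts) = polish t ++ polishes ts

  polishs≡polishes : ∀ {m} (ts : Vec Tree m) → polishs ts ≡ polishes (toList ts)
  polishs≡polishes []       = refl
  polishs≡polishes (t ∷ ts) = cong (polish t ++_) (polishs≡polishes ts)

  polishes-∷ʳ : ∀ ts t → polishes (ts ∷ʳ t) ≡ polishes ts ++ polish t
  polishes-∷ʳ []       t = ++-identityʳ (polish t)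
  polishes-∷ʳ (u ∷ ts) t =
    trans (cong (polish u ++_) (polishes-∷ʳ ts t)) (sym (++-assoc (polish u) _ _))

  module Automaton (positive : ∀ i → 1 ≤ ar i) (Y : List Tree) where

    E D : ℕ
    E = maxHeight Y
    D = suc E

    -- An open vertex: its label and the truncations of the children read so far.
    Frame : Set
    Frame = Σ (Fin k) λ i → BoundedList (Shape E) (ar i)

    StackSymbol : Set
    StackSymbol = Maybe Frame

    pattern bottom = nothing
    pattern frame i L L<ar = just (i , L , L<ar)

    frame-cong : ∀ {i} {L L′ : List (Shape E)} {L<ar : length L < ar i} {L′<ar : length L′ < ar i} →
                 L ≡ L′ → _≡_ {A = StackSymbol} (frame i L L<ar) (frame i L′ L′<ar)
    frame-cong {L<ar = L<ar} {L′<ar} refl = cong (frame _ _) (<-irrelevant L<ar L′<ar)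

    data State : Set where
      read done : State
      completed : Shape D → State

    isDone : State → Bool
    isDone done = true
    isDone _    = false

    Move : Set
    Move = Maybe (State × List StackSymbol)

    finish : Shape D → List StackSymbol → Move
    finish σ γ with admissible? Y σ
    ... | yes _ = just (completed σ , γ)
    ... | no  _ = nothing

    settle : ∀ i (L : List (Shape E)) → length L ≤ ar i → Move
    settle i L L≤ar with m≤n⇒m<n∨m≡n L≤ar
    ... | inj₁ L<ar = just (read , frame i L L<ar ∷ [])
    ... | inj₂ L≡ar = finish (snode i (toVec L L≡ar)) []

    δε : State → StackSymbol → Move
    δε (completed σ) bottom           = just (done , bottom ∷ [])
    δε (completed σ) (frame i L L<ar) =
      settle i (L ∷ʳ lower σ) (subst (_≤ ar i) (sym (length-∷ʳ L)) L<ar)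
    δε _             _                = nothing

    δ : State → Label → StackSymbol → Move
    δ read zero    Z = finish sleaf (Z ∷ [])
    δ read (suc i) Z = just (read , frame i [] (positive i) ∷ Z ∷ [])
    δ _    _       _ = nothing

    deterministic : ∀ q Z → δε q Z ≢ nothing → ∀ a → δ q a Z ≡ nothing
    deterministic read          _ δε≢nothing _ = contradiction refl δε≢nothing
    deterministic done          _ _          _ = refl
    deterministic (completed _) _ _          _ = refl

    machine : DPDAOver Label State StackSymbol
    machine = record
      { q₀ = read ; Z₀ = bottom ; final = isDone ; δε = δε ; δ = δ ; deterministic = deterministic }

    enumerate-State : Enumerable State
    enumerate-State = read ∷ done ∷ map completed shapes , λ where
        read          → here refl
        done          → there (here refl)
        (completed σ) → there (there (∈-map⁺ completed (shapes∋ σ)))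
      where open Σ (enumerate-Shape D) renaming (proj₁ to shapes; proj₂ to shapes∋)

    enumerate-StackSymbol : Enumerable StackSymbol
    enumerate-StackSymbol = enumerate-Maybe (enumerate-Σ (enumerate-Fin k) λ i →
                              enumerate-BoundedList (enumerate-Shape E) (ar i))

    open DPDAOver machine using (Config; _⊢_; _⊢*_; ε-step; a-step; Accepts)

    finish⇒admissible : ∀ {σ γ q γ′} → finish σ γ ≡ just (q , γ′) →
                        Admissible Y σ × q ≡ completed σ × γ′ ≡ γ
    finish⇒admissible {σ} eq with admissible? Y σ
    finish⇒admissible refl | yes adm = adm , refl , refl

    admissible⇒finish : ∀ {σ γ} → Admissible Y σ → finish σ γ ≡ just (completed σ , γ)
    admissible⇒finish {σ} adm with admissible? Y σ
    ... | yes _   = refl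
    ... | no ¬adm = contradiction adm ¬adm

    data Settles (i : Fin k) (L : List (Shape E)) : State → List StackSymbol → Set where
      pending  : (L<ar : length L < ar i) → Settles i L read (frame i L L<ar ∷ [])
      complete : (L≡ar : length L ≡ ar i) → Admissible Y (snode i (toVec L L≡ar)) →
                 Settles i L (completed (snode i (toVec L L≡ar))) []

    settle⇒Settles : ∀ {i L L≤ar q γ} → settle i L L≤ar ≡ just (q , γ) → Settles i L q γ
    settle⇒Settles {L≤ar = L≤ar} eq with m≤n⇒m<n∨m≡n L≤ar
    settle⇒Settles refl | inj₁ L<ar = pending L<ar
    settle⇒Settles eq   | inj₂ L≡ar with finish⇒admissible eq
    ... | adm , refl , refl = complete L≡ar adm

    Settles⇒settle : ∀ {i L L≤ar q γ} → Settles i L q γ → settle i L L≤ar ≡ just (q , γ)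
    Settles⇒settle {L≤ar = L≤ar} (pending L<ar) with m≤n⇒m<n∨m≡n L≤ar
    ... | inj₁ L<ar′ = cong (λ lt → just (read , frame _ _ lt ∷ [])) (<-irrelevant L<ar′ L<ar)
    ... | inj₂ L≡ar  = contradiction L≡ar (<⇒≢ L<ar)
    Settles⇒settle {L≤ar = L≤ar} (complete L≡ar adm) with m≤n⇒m<n∨m≡n L≤ar
    ... | inj₁ L<ar = contradiction L≡ar (<⇒≢ L<ar)
    ... | inj₂ _    = admissible⇒finish adm

    bounded : ∀ {p} → p ∈ Y → height p ≤ D
    bounded = m≤n⇒m≤1+n ∘ height≤maxHeight

    map-truncate-∷ʳ : ∀ cs t → map (truncate E) cs ∷ʳ lower (truncate D t) ≡ map (truncate E) (cs ∷ʳ t)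
    map-truncate-∷ʳ cs t =
      trans (cong (map (truncate E) cs ∷ʳ_) (lower-truncate E t)) (sym (map-++ _ cs (t ∷ [])))

    record PartialNode : Set where
      constructor partial
      field
        label    : Fin k
        children : List Tree
        unfilled : length children < ar label
        avoiding : All (Avoids Y) children

    ⌈_⌉ : PartialNode → StackSymbol
    ⌈ partial i cs cs<ar _ ⌉ =
      frame i (map (truncate E) cs) (subst (_< ar i) (sym (length-map _ cs)) cs<ar)

    opened : List PartialNode → List Label
    opened []                      = []
    opened (partial i cs _ _ ∷ Fs) = opened Fs ++ suc i ∷ polishes cs

    Explains : List Label → State → List Label → List PartialNode → Set
    Explains w₀ read          w Fs = w₀ ≡ opened Fs ++ w
    Explains w₀ (completed σ) w Fs =
      Σ Tree λ t → σ ≡ truncate D t × Avoids Y t × w₀ ≡ opened Fs ++ polish t ++ w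
    Explains w₀ done          w _  = Σ Tree λ t → Avoids Y t × w₀ ≡ polish t ++ w

    -- The soundness invariant: the stack abstracts the open vertices (innermost first), and the
    -- input consumed so far consists of their Polish prefixes, outermost first, followed in a state
    -- completed σ by a subtree avoiding Y whose truncation is σ.
    Consistent : List Label → Config → Set
    Consistent w₀ (q , w , s) =
      Σ (List PartialNode) λ Fs → s ≡ map ⌈_⌉ Fs ++ bottom ∷ [] × Explains w₀ q w Fs

    opened-child : ∀ P i cs t w →
                   (P ++ suc i ∷ polishes cs) ++ polish t ++ w ≡ P ++ (suc i ∷ polishes (cs ∷ʳ t)) ++ w
    opened-child P i cs t w = begin
      (P ++ suc i ∷ polishes cs) ++ polish t ++ w  ≡⟨ ++-assoc P _ _ ⟩
      P ++ suc i ∷ polishes cs ++ polish t ++ w    ≡⟨ cong (λ x → P ++ suc i ∷ x) (++-assoc (polishes cs) _ _) ⟨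
      P ++ suc i ∷ (polishes cs ++ polish t) ++ w  ≡⟨ cong (λ x → P ++ suc i ∷ x ++ w) (polishes-∷ʳ cs t) ⟨
      P ++ suc i ∷ polishes (cs ∷ʳ t) ++ w         ∎
      where open ≡-Reasoning

    settle-consistent : ∀ {w₀ w i L L≤ar q γ} Fs cs → L ≡ map (truncate E) cs → All (Avoids Y) cs →
                        settle i L L≤ar ≡ just (q , γ) → w₀ ≡ opened Fs ++ (suc i ∷ polishes cs) ++ w →
                        Consistent w₀ (q , w , γ ++ map ⌈_⌉ Fs ++ bottom ∷ [])
    settle-consistent {w₀} {w} {i} {L≤ar = L≤ar} Fs cs refl avs eq w₀≡
      with settle⇒Settles {i} {map (truncate E) cs} {L≤ar} eq
    ... | pending L<ar =
      partial i cs (subst (_< ar i) (length-map _ cs) L<ar) avs ∷ Fs ,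
      cong (_∷ map ⌈_⌉ Fs ++ bottom ∷ []) (frame-cong refl) ,
      trans w₀≡ (sym (++-assoc (opened Fs) _ w))
    ... | complete L≡ar adm =
      Fs , refl , node i ts , shape≡ , avoids-node bounded (subst (Admissible Y) shape≡ adm) avoids-ts ,
      trans w₀≡ (cong (λ x → opened Fs ++ suc i ∷ x ++ w) (sym polish≡))
      where
      cs≡ar : length cs ≡ ar i
      cs≡ar = trans (sym (length-map _ cs)) L≡ar

      ts : Vec Tree (ar i)
      ts = toVec cs cs≡ar

      toList-ts : toList ts ≡ cs
      toList-ts = toList-toVec cs cs≡ar

      shape≡ : snode i (toVec (map (truncate E) cs) L≡ar) ≡ truncate D (node i ts)
      shape≡ = truncate-node E ts toList-ts L≡ar

      avoids-ts : VAll.All (Avoids Y) ts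
      avoids-ts = VAllP.toList⁻ (subst (All (Avoids Y)) (sym toList-ts) avs)

      polish≡ : polishs ts ≡ polishes cs
      polish≡ = trans (polishs≡polishes ts) (cong polishes toList-ts)

    step-consistent : ∀ {w₀ c c′} → c ⊢ c′ → Consistent w₀ c → Consistent w₀ c′
    step-consistent (a-step {q = read} {a = zero} e) (Fs , s≡ , w₀≡) with finish⇒admissible e
    ... | adm , refl , refl = Fs , s≡ , leaf , refl , avoids-leaf bounded adm , w₀≡
    step-consistent (a-step {q = read} {a = suc i} {w = w} refl) (Fs , s≡ , w₀≡) =
      partial i [] (positive i) [] ∷ Fs , cong (_ ∷_) s≡ ,
      trans w₀≡ (sym (++-assoc (opened Fs) (suc i ∷ []) w))
    step-consistent (ε-step {q = completed _} refl) ([] , refl , t , refl , avoids , w₀≡) =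
      [] , refl , t , avoids , w₀≡
    step-consistent (ε-step {q = completed _} {w = w} e)
                    (partial i cs _ avs ∷ Fs , refl , t , refl , avoids , w₀≡) =
      settle-consistent Fs (cs ∷ʳ t) (map-truncate-∷ʳ cs t) (AllP.++⁺ avs (avoids ∷ [])) e
                        (trans w₀≡ (opened-child (opened Fs) i cs t w))
    step-consistent (a-step {q = completed _} ())
    step-consistent (a-step {q = done} ())
    step-consistent (ε-step {q = read} ())
    step-consistent (ε-step {q = done} ())

    run-consistent : ∀ {w₀ c c′} → c ⊢* c′ → Consistent w₀ c → Consistent w₀ c′
    run-consistent ε            consistent = consistent
    run-consistent (step ◅ run) consistent = run-consistent run (step-consistent step consistent)

    accepted⇒avoiding : ∀ w → Accepts w → L Y w
    accepted⇒avoiding w (done , _ , _ , run) with run-consistent run ([] , refl , refl)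
    ... | _ , _ , t , avoids , w≡ = t , avoids , sym (trans w≡ (++-identityʳ (polish t)))

    child-step : ∀ {i L L′ L<ar σ w s} → L ∷ʳ lower σ ≡ L′ → (L′<ar : length L′ < ar i) →
                 (completed σ , w , frame i L L<ar ∷ s) ⊢ (read , w , frame i L′ L′<ar ∷ s)
    child-step refl L′<ar = ε-step (Settles⇒settle (pending L′<ar))

    last-child-step : ∀ {i L L′ L<ar σ σ′ w s} → L ∷ʳ lower σ ≡ L′ → (L′≡ar : length L′ ≡ ar i) →
                      snode i (toVec L′ L′≡ar) ≡ σ′ → Admissible Y σ′ →
                      (completed σ , w , frame i L L<ar ∷ s) ⊢ (completed σ′ , w , s)
    last-child-step refl L′≡ar refl adm = ε-step (Settles⇒settle (complete L′≡ar adm))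

    length-map-truncate : ∀ {i} (ts : Vec Tree (ar i)) {cs} → toList ts ≡ cs →
                          length (map (truncate E) cs) ≡ ar i
    length-map-truncate ts refl = trans (length-map _ (toList ts)) (length-toList ts)

    length-map-truncate< : ∀ {i} (ts : Vec Tree (ar i)) {cs r rs} → toList ts ≡ cs ++ r ∷ rs →
                           length (map (truncate E) cs) < ar i
    length-map-truncate< {i} ts {cs} {r} {rs} split = begin-strict
      length (map (truncate E) cs)  ≡⟨ length-map _ cs ⟩
      length cs                     <⟨ m<m+n (length cs) z<s ⟩
      length cs + length (r ∷ rs)   ≡⟨ length-++ cs ⟨
      length (cs ++ r ∷ rs)         ≡⟨ cong length split ⟨
      length (toList ts)            ≡⟨ length-toList ts ⟩
      ar i                          ∎
      where open ≤-Reasoning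

    reassociate : ∀ u v {w s c} → (read , u ++ v ++ w , s) ⊢* c → (read , (u ++ v) ++ w , s) ⊢* c
    reassociate u v {w} {s} {c} = subst (λ x → (read , x , s) ⊢* c) (sym (++-assoc u v w))

    mutual
      read-tree : ∀ {w Z s} t → Avoids Y t →
                  (read , polish t ++ w , Z ∷ s) ⊢* (completed (truncate D t) , w , Z ∷ s)
      read-tree leaf        avoids = a-step (admissible⇒finish (avoids⇒admissible D avoids)) ◅ ε
      read-tree (node i ts) avoids =
        a-step refl ◅
        read-children ts avoids [] ts refl (avoids-children λ p p∈Y → avoids p p∈Y ∘ there) (positive i)

      read-children : ∀ {i m w s} (ts : Vec Tree (ar i)) → Avoids Y (node i ts) →
                      (cs : List Tree) (rs : Vec Tree m) →
                      toList ts ≡ cs ++ toList rs → VAll.All (Avoids Y) rs →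
                      (L<ar : length (map (truncate E) cs) < ar i) →
                      (read , polishs rs ++ w , frame i (map (truncate E) cs) L<ar ∷ s) ⊢*
                      (completed (truncate D (node i ts)) , w , s)
      read-children ts _ cs [] split _ L<ar =
        contradiction (length-map-truncate ts (trans split (++-identityʳ cs))) (<⇒≢ L<ar)
      read-children ts avoids cs (r ∷ []) split (avoids-r VAll.∷ _) _ =
        reassociate (polish r) [] (read-tree r avoids-r) ◅◅
        last-child-step (map-truncate-∷ʳ cs r) (length-map-truncate ts split)
                        (truncate-node E ts split (length-map-truncate ts split))
                        (avoids⇒admissible D avoids) ◅ ε
      read-children ts avoids cs (r ∷ r′ ∷ rs) split (avoids-r VAll.∷ avss) _ =
        reassociate (polish r) (polishs (r′ ∷ rs)) (read-tree r avoids-r) ◅◅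
        child-step (map-truncate-∷ʳ cs r) L′<ar ◅
        read-children ts avoids (cs ∷ʳ r) (r′ ∷ rs) split′ avss L′<ar
        where
        split′ : toList ts ≡ (cs ∷ʳ r) ++ toList (r′ ∷ rs)
        split′ = trans split (sym (++-assoc cs (r ∷ []) _))

        L′<ar : length (map (truncate E) (cs ∷ʳ r)) < _
        L′<ar = length-map-truncate< ts split′

    avoiding⇒accepted : ∀ w → L Y w → Accepts w
    avoiding⇒accepted _ (t , avoids , refl) =
      done , bottom ∷ [] , refl ,
      subst (λ v → (read , v , bottom ∷ []) ⊢* (completed (truncate D t) , [] , bottom ∷ []))
            (++-identityʳ (polish t)) (read-tree t avoids)
      ◅◅ (ε-step refl ◅ ε)

    language≡accepted : ∀ w → L Y w ⇔ Accepts w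
    language≡accepted w = mk⇔ (avoiding⇒accepted w) (accepted⇒avoiding w)

theorem4p1 : (d k : ℕ) (ar : Fin k → ℕ) → 0 < d → (∀ i → 1 ≤ ar i × ar i ≤ d) →
    (Y : List (Trees.Tree ar)) → DeterministicCF (Trees.L ar Y)
theorem4p1 _ k ar _ arities Y =
  deterministicCF machine enumerate-State enumerate-StackSymbol language≡accepted
  where open Automaton ar (proj₁ ∘ arities) Y
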